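{- Let $k\ge 3$ and for a natural number $m$ write $m':=m[k\leftarrow k+1]$, $m'':=m\langle k\leftarrow k+1\rangle$, $m''':=m\{k\leftarrow k+1\}$. Then: 1. $m\le m'$, $m\le m''$ and $m\le m'''$. Moreover, for all natural numbers $a,b$ (even if $A_a(k,b)$ is not written in $k$-normal form) $A_a(k,b)\le A_{a[k\leftarrow k+1]}(k+1,b[k\leftarrow k+1])$, $A_a(k,b)\le A_{a\langle k\leftarrow k+1\rangle}(k+1,b\langle k\leftarrow k+1\rangle)$ and $A_a(k,b)\le A_{a\{k\leftarrow k+1\}}(k+1,b\{k\leftarrow k+1\})$. 2. If $m\ge k$ then $m<m'$, $m<m''$ and $m<m'''$. 3. If $m>0$ then $(m-1)'<m'$, $(m-1)''<m''$ and $(m-1)'''<m'''$. 4. If $m=_{k\text{ -nf}}A_a(k,b)+l$ then $m'=_{(k+1)\text{ -nf}}A_{a'}(k+1,b')+l$, $m''=_{(k+1)\text{ -nf}}A_a(k+1,b'')+l$ and $m'''=_{(k+1)\text{ -nf}}A_{a'''}(k+1,b)+l$.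
   Context: For natural numbers $k,a,b$: $A_0(k,b):=b+1$, $A_{a+1}(k,0):=A_a(k,\cdot)^k(0)$, $A_{a+1}(k,b+1):=A_a(k,\cdot)^k(A_{a+1}(k,b))$, where the upper index denotes iteration of $x\mapsto A_a(k,x)$. For $k\ge3$ and $m>0$ there are unique $a,b,l$ with $m=A_a(k,b)+l$, $a$ maximal with $A_a(k,0)\le m$ and $b$ maximal with $A_a(k,b)\le m$; this is written $m=_{k\text{ -nf}}A_a(k,b)+l$ (and similarly $=_{(k+1)\text{ -nf}}$ for parameter $k+1$). Base changes (by recursion on $m$): $0[k\leftarrow k+1]=0\langle k\leftarrow k+1\rangle=0\{k\leftarrow k+1\}=0$; if $m=_{k\text{ -nf}}A_a(k,b)+l>0$ then $m[k\leftarrow k+1]:=A_{a[k\leftarrow k+1]}(k+1,b[k\leftarrow k+1])+l$, $m\langle k\leftarrow k+1\rangle:=A_a(k+1,b\langle k\leftarrow k+1\rangle)+l$, $m\{k\leftarrow k+1\}:=A_{a\{k\leftarrow k+1\}}(k+1,b)+l$. -}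

module Defs where

open import Data.Nat using (ℕ; zero; suc; _+_; _∸_; _≤_)
open import Data.Product using (_×_)
open import Relation.Binary.PropositionalEquality using (_≡_)
open import Data.Bool using (Bool; true; false; if_then_else_)

iter : ℕ → (ℕ → ℕ) → ℕ → ℕ
iter zero    f x = x
iter (suc n) f x = f (iter n f x)

-- Ack a k b  =  A_a(k,b)
Ack : ℕ → ℕ → ℕ → ℕ
Ack zero    k b       = suc b
Ack (suc a) k zero    = iter k (Ack a k) 0
Ack (suc a) k (suc b) = iter k (Ack a k) (Ack (suc a) k b)

NF : ℕ → ℕ → ℕ → ℕ → ℕ → Set
NF k m a b l =
  (m ≡ Ack a k b + l)
  × (Ack a k 0 ≤ m) × (∀ a′ → Ack a′ k 0 ≤ m → a′ ≤ a)
  × (Ack a k b ≤ m) × (∀ b′ → Ack a k b′ ≤ m → b′ ≤ b)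

-- largest i ≤ n with g i ≤ m, and 0 if there is none
-- (≤ is tested by the lazy structural test leqᵇ, so that huge values
--  g i are never fully evaluated; leqᵇ x y ≡ true  iff  x ≤ y)
leqᵇ : ℕ → ℕ → Bool
leqᵇ zero    y       = true
leqᵇ (suc x) zero    = false
leqᵇ (suc x) (suc y) = leqᵇ x y

maxBelow : (ℕ → ℕ) → ℕ → ℕ → ℕ
maxBelow g m zero = zero
maxBelow g m (suc n) = if leqᵇ (g (suc n)) m then suc n else maxBelow g m n

-- the components a, b, l of the k-normal form of m (computed by bounded
-- search; for k ≥ 3 and m > 0 one has a < m and b < m)
nfa : ℕ → ℕ → ℕ
nfa k m = maxBelow (λ a → Ack a k 0) m m

nfb : ℕ → ℕ → ℕ
nfb k m = maxBelow (λ b → Ack (nfa k m) k b) m m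

nfl : ℕ → ℕ → ℕ
nfl k m = m ∸ Ack (nfa k m) k (nfb k m)

-- base changes with fuel (fuel suc m suffices, since a,b < m)
bcSqF : ℕ → ℕ → ℕ → ℕ
bcSqF k zero    m       = 0
bcSqF k (suc n) zero    = 0
bcSqF k (suc n) (suc m) =
  Ack (bcSqF k n (nfa k (suc m))) (suc k) (bcSqF k n (nfb k (suc m))) + nfl k (suc m)

bcAngF : ℕ → ℕ → ℕ → ℕ
bcAngF k zero    m       = 0
bcAngF k (suc n) zero    = 0
bcAngF k (suc n) (suc m) =
  Ack (nfa k (suc m)) (suc k) (bcAngF k n (nfb k (suc m))) + nfl k (suc m)

bcCurF : ℕ → ℕ → ℕ → ℕ
bcCurF k zero    m       = 0
bcCurF k (suc n) zero    = 0
bcCurF k (suc n) (suc m) =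
  Ack (bcCurF k n (nfa k (suc m))) (suc k) (nfb k (suc m)) + nfl k (suc m)

bcSq : ℕ → ℕ → ℕ
bcSq k m = bcSqF k (suc m) m

bcAng : ℕ → ℕ → ℕ
bcAng k m = bcAngF k (suc m) m

bcCur : ℕ → ℕ → ℕ
bcCur k m = bcCurF k (suc m) m

module Submission where

-- The three base changes m[k ← k+1], m⟨k ← k+1⟩ and m{k ← k+1} differ only in
-- whether the index a and/or the argument b of the normal form are changed
-- recursively.  We therefore treat them uniformly: a fuelled recursion F with two
-- flags s, t ("change a", "change b"), of which the three base changes of Defs are
-- literal instances.
--
-- The heart is a single induction on m establishing simultaneously that
-- the base change φ is strictly increasing on [0,m] and maps k-normal forms of
-- numbers ≤ m to (k+1)-normal forms; all four parts of the theorem follow.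

open import Defs
open import Data.Nat using (ℕ; zero; suc; _+_; _∸_; _≤_; _<_; _≤′_; ≤′-refl; ≤′-step; z≤n; s≤s; s≤s⁻¹)
open import Data.Nat.Properties
open import Data.Product using (_×_; _,_; proj₁; proj₂)
open import Data.Sum using (_⊎_; inj₁; inj₂)
open import Data.Bool using (Bool; true; false)
open import Data.Empty using (⊥-elim)
open import Relation.Binary.Core using (_Preserves_⟶_)
open import Relation.Binary.PropositionalEquality

Inflationary : (ℕ → ℕ) → Set
Inflationary f = ∀ x → x < f x

Monotone : (ℕ → ℕ) → Set
Monotone f = f Preserves _≤_ ⟶ _≤_

StrictlyMonotone : (ℕ → ℕ) → Set
StrictlyMonotone f = f Preserves _<_ ⟶ _<_

strictlyMonotone⇒monotone : ∀ {f} → StrictlyMonotone f → Monotone f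
strictlyMonotone⇒monotone sm x≤y with m≤n⇒m<n∨m≡n x≤y
... | inj₁ x<y  = <⇒≤ (sm x<y)
... | inj₂ refl = ≤-refl

stepwise⇒strictlyMonotone : ∀ {f} → (∀ x → f x < f (suc x)) → StrictlyMonotone f
stepwise⇒strictlyMonotone {f} step x<y = go (≤⇒≤′ x<y)
  where
  go : ∀ {x y} → suc x ≤′ y → f x < f y
  go ≤′-refl     = step _
  go (≤′-step p) = <-trans (go p) (step _)

strictlyMonotone-+ : ∀ {G} → StrictlyMonotone G → ∀ y d → G y + d ≤ G (y + d)
strictlyMonotone-+ {G} sm y zero = ≤-reflexive (trans (+-identityʳ (G y)) (cong G (sym (+-identityʳ y))))
strictlyMonotone-+ {G} sm y (suc d) = begin
  G y + suc d       ≡⟨ +-suc (G y) d ⟩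
  suc (G y + d)     ≤⟨ s≤s (strictlyMonotone-+ sm y d) ⟩
  suc (G (y + d))   ≤⟨ sm (n<1+n (y + d)) ⟩
  G (suc (y + d))   ≡⟨ cong G (sym (+-suc y d)) ⟩
  G (y + suc d)     ∎
  where open ≤-Reasoning

slack-preserved : ∀ {G} → StrictlyMonotone G → ∀ {y y' l} → y ≤ y' → y + l < G y → y' + l < G y'
slack-preserved {G} sm {y} {y'} {l} y≤y' fits =
  subst (λ z → z + l < G z) (m+[n∸m]≡n y≤y') (shifted (y' ∸ y))
  where
  shifted : ∀ d → (y + d) + l < G (y + d)
  shifted d = begin-strict
    (y + d) + l   ≡⟨ +-assoc y d l ⟩
    y + (d + l)   ≡⟨ cong (y +_) (+-comm d l) ⟩
    y + (l + d)   ≡⟨ sym (+-assoc y l d) ⟩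
    (y + l) + d   <⟨ +-monoˡ-< d fits ⟩
    G y + d       ≤⟨ strictlyMonotone-+ sm y d ⟩
    G (y + d)     ∎
    where open ≤-Reasoning

iter-inflationary : ∀ {f} → Inflationary f → ∀ n x → x ≤ iter n f x
iter-inflationary infl zero    x = ≤-refl
iter-inflationary infl (suc n) x = <⇒≤ (≤-<-trans (iter-inflationary infl n x) (infl _))

iter-suc-inflationary : ∀ {f} → Inflationary f → ∀ n x → x < iter (suc n) f x
iter-suc-inflationary infl n x = ≤-<-trans (iter-inflationary infl n x) (infl _)

iter-mono-count : ∀ {f} → Inflationary f → ∀ {n n'} → n ≤ n' → ∀ x → iter n f x ≤ iter n' f x
iter-mono-count {f} infl n≤n' x = go (≤⇒≤′ n≤n')
  where
  go : ∀ {n n'} → n ≤′ n' → iter n f x ≤ iter n' f x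
  go ≤′-refl     = ≤-refl
  go (≤′-step p) = ≤-trans (go p) (<⇒≤ (infl _))

iter-strictlyMonotone : ∀ {f} → StrictlyMonotone f → ∀ n → StrictlyMonotone (iter n f)
iter-strictlyMonotone sm zero    x<y = x<y
iter-strictlyMonotone sm (suc n) x<y = sm (iter-strictlyMonotone sm n x<y)

iter-monotone : ∀ {f} → Monotone f → ∀ n → Monotone (iter n f)
iter-monotone mono zero    x≤y = x≤y
iter-monotone mono (suc n) x≤y = mono (iter-monotone mono n x≤y)

iter-pointwise : ∀ {f g} → Monotone g → (∀ x → f x ≤ g x) → ∀ n x → iter n f x ≤ iter n g x
iter-pointwise mono f≤g zero    x = ≤-refl
iter-pointwise mono f≤g (suc n) x = ≤-trans (f≤g _) (mono (iter-pointwise mono f≤g n x))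

-- A_1(k,0) = k.
iter-suc-zero : ∀ n → iter n suc 0 ≡ n
iter-suc-zero zero    = refl
iter-suc-zero (suc n) = cong suc (iter-suc-zero n)

Ack-inflationary : ∀ k a → Inflationary (Ack a (suc k))
Ack-inflationary k zero    b       = ≤-refl
Ack-inflationary k (suc a) zero    = iter-suc-inflationary (Ack-inflationary k a) k 0
Ack-inflationary k (suc a) (suc b) =
  ≤-<-trans (Ack-inflationary k (suc a) b) (iter-suc-inflationary (Ack-inflationary k a) k _)

Ack-positive : ∀ k a b → 0 < Ack a (suc k) b
Ack-positive k a b = ≤-<-trans z≤n (Ack-inflationary k a b)

Ack-step : ∀ k a b → Ack a (suc k) b < Ack a (suc k) (suc b)
Ack-step k zero    b = ≤-refl
Ack-step k (suc a) b = iter-suc-inflationary (Ack-inflationary k a) k _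

Ack-strictlyMonotone : ∀ k a → StrictlyMonotone (Ack a (suc k))
Ack-strictlyMonotone k a = stepwise⇒strictlyMonotone (Ack-step k a)

Ack-monotone : ∀ k a → Monotone (Ack a (suc k))
Ack-monotone k a = strictlyMonotone⇒monotone (Ack-strictlyMonotone k a)

Ack-index-step : ∀ k a b → Ack a (suc k) b ≤ Ack (suc a) (suc k) b
Ack-index-step k a zero    = Ack-monotone k a z≤n
Ack-index-step k a (suc b) =
  Ack-monotone k a (≤-trans (Ack-inflationary k (suc a) b) (iter-inflationary (Ack-inflationary k a) k _))

Ack-monotone-index : ∀ k {a a'} b → a ≤ a' → Ack a (suc k) b ≤ Ack a' (suc k) b
Ack-monotone-index k b a≤a' = go (≤⇒≤′ a≤a')
  where
  go : ∀ {a a'} → a ≤′ a' → Ack a (suc k) b ≤ Ack a' (suc k) b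
  go ≤′-refl     = ≤-refl
  go (≤′-step p) = ≤-trans (go p) (Ack-index-step k _ b)

Ack-monotone-param : ∀ k a b → Ack a k b ≤ Ack a (suc k) b
Ack-strict-param   : ∀ k a b → Ack (suc a) k b < Ack (suc a) (suc k) b

Ack-monotone-param k zero    b = ≤-refl
Ack-monotone-param k (suc a) b = <⇒≤ (Ack-strict-param k a b)

Ack-strict-param k a zero =
  ≤-<-trans (iter-pointwise (Ack-monotone k a) (Ack-monotone-param k a) k 0) (Ack-inflationary k a _)
Ack-strict-param k a (suc b) =
  ≤-<-trans (iter-pointwise (Ack-monotone k a) (Ack-monotone-param k a) k _)
    (≤-<-trans (iter-monotone (Ack-monotone k a) k (<⇒≤ (Ack-strict-param k a b))) (Ack-inflationary k a _))

Ack-monotone-all : ∀ k {a a' b b'} → a ≤ a' → b ≤ b' → Ack a k b ≤ Ack a' (suc k) b'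
Ack-monotone-all k {a} {a'} {b} a≤a' b≤b' =
  ≤-trans (Ack-monotone-param k a b) (≤-trans (Ack-monotone-index k b a≤a') (Ack-monotone k a' b≤b'))

index<Ack-zero : ∀ k a → a < Ack a (suc (suc k)) 0
index<Ack-zero k zero    = s≤s z≤n
index<Ack-zero k (suc a) =
  ≤-<-trans (index<Ack-zero k a) (Ack-strictlyMonotone (suc k) a (Ack-positive (suc k) a _))

-- The tail lemma.  If the remainder l of A_a(k,b) + l stays below A_a(k,b+1),
-- it still does after raising a, b and the parameter k; this is the argument
-- condition of the new normal form.
tail-fits : ∀ k {a a' b b' l} → a ≤ a' → b ≤ b'
          → Ack a (suc k) b + l < Ack a (suc k) (suc b)
          → Ack a' (suc (suc k)) b' + l < Ack a' (suc (suc k)) (suc b')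
tail-fits k {zero} {a'} {b' = b'} {zero} _ _ _ =
  subst (_< Ack a' (suc (suc k)) (suc b')) (sym (+-identityʳ _)) (Ack-step (suc k) a' b')
tail-fits k {zero} {a'} {b} {b'} {suc l} _ _ fits = ⊥-elim (m+1+n≰m b (s≤s⁻¹ (s≤s⁻¹ fits)))
tail-fits k {suc a} {suc a'} {b} {b'} {l} (s≤s a≤a') b≤b' fits = begin-strict
  y' + l                                    <⟨ slack-preserved (iter-strictlyMonotone (Ack-strictlyMonotone k a) (suc k))
                                                  (Ack-monotone-all (suc k) (s≤s a≤a') b≤b') fits ⟩
  iter (suc k) (Ack a (suc k)) y'           ≤⟨ iter-pointwise (Ack-monotone (suc k) a')
                                                  (λ x → Ack-monotone-all (suc k) a≤a' ≤-refl) (suc k) y' ⟩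
  iter (suc k) (Ack a' (suc (suc k))) y'    <⟨ Ack-inflationary (suc k) a' _ ⟩
  Ack (suc a') (suc (suc k)) (suc b')       ∎
  where
  open ≤-Reasoning
  y' : ℕ
  y' = Ack (suc a') (suc (suc k)) b'

leqᵇ-sound : ∀ x y → leqᵇ x y ≡ true → x ≤ y
leqᵇ-sound zero    y       _ = z≤n
leqᵇ-sound (suc x) zero    ()
leqᵇ-sound (suc x) (suc y) e = s≤s (leqᵇ-sound x y e)

leqᵇ-complete : ∀ {x y} → x ≤ y → leqᵇ x y ≡ true
leqᵇ-complete z≤n       = refl
leqᵇ-complete (s≤s x≤y) = leqᵇ-complete x≤y

maxBelow-satisfies : ∀ (g : ℕ → ℕ) m n → g 0 ≤ m → g (maxBelow g m n) ≤ m
maxBelow-satisfies g m zero    g0≤m = g0≤m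
maxBelow-satisfies g m (suc n) g0≤m with leqᵇ (g (suc n)) m in eq
... | true  = leqᵇ-sound _ _ eq
... | false = maxBelow-satisfies g m n g0≤m

maxBelow-maximal : ∀ (g : ℕ → ℕ) m n i → i ≤ n → g i ≤ m → i ≤ maxBelow g m n
maxBelow-maximal g m zero    i z≤n _ = z≤n
maxBelow-maximal g m (suc n) i i≤n gi≤m with leqᵇ (g (suc n)) m in eq
... | true  = i≤n
... | false with m≤n⇒m<n∨m≡n i≤n
...   | inj₁ i<n  = maxBelow-maximal g m n i (s≤s⁻¹ i<n) gi≤m
...   | inj₂ refl with trans (sym (leqᵇ-complete gi≤m)) eq
...     | ()

-- Normal forms.  The maximality conditions of NF are equivalent (for k ≥ 1) to two
-- strict upper bounds, which are what the induction works with.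

record NFBounds (k m a b l : ℕ) : Set where
  constructor nfBounds
  field
    decomposition    : m ≡ Ack a k b + l
    below-next-arg   : m < Ack a k (suc b)
    below-next-index : m < Ack (suc a) k 0
open NFBounds

NFBounds-Ack≤ : ∀ {k m a b l} → NFBounds k m a b l → Ack a k b ≤ m
NFBounds-Ack≤ {l = l} nf = subst (_ ≤_) (sym (decomposition nf)) (m≤m+n _ l)

index-bound : ∀ k {m a a'} → Ack a' (suc k) 0 ≤ m → m < Ack (suc a) (suc k) 0 → a' ≤ a
index-bound k lo hi = ≮⇒≥ (λ a<a' → <⇒≱ hi (≤-trans (Ack-monotone-index k 0 a<a') lo))

argument-bound : ∀ k {m a b d} → Ack a (suc k) b ≤ m → m < Ack a (suc k) d → b < d
argument-bound k {a = a} lo hi = ≰⇒> (λ d≤b → <⇒≱ hi (≤-trans (Ack-monotone k a d≤b) lo))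

NF⇒NFBounds : ∀ {k m a b l} → NF k m a b l → NFBounds k m a b l
NF⇒NFBounds (e , _ , a-max , _ , b-max) =
  nfBounds e (≰⇒> (λ le → 1+n≰n (b-max _ le))) (≰⇒> (λ le → 1+n≰n (a-max _ le)))

NFBounds⇒NF : ∀ {k m a b l} → NFBounds (suc k) m a b l → NF (suc k) m a b l
NFBounds⇒NF {k} {m} {a} {b} nf@(nfBounds e below-arg below-index) =
  e , ≤-trans (Ack-monotone k a z≤n) Ab≤m , a-max , Ab≤m , b-max
  where
  Ab≤m : Ack a (suc k) b ≤ m
  Ab≤m = NFBounds-Ack≤ nf
  a-max : ∀ a′ → Ack a′ (suc k) 0 ≤ m → a′ ≤ a
  a-max a′ le = index-bound k le below-index
  b-max : ∀ b′ → Ack a (suc k) b′ ≤ m → b′ ≤ b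
  b-max b′ le = s≤s⁻¹ (argument-bound k {a = a} {b = b′} le below-arg)

NF-unique : ∀ {k m a b l a′ b′ l′} → NF k m a b l → NF k m a′ b′ l′ → (a ≡ a′) × (b ≡ b′) × (l ≡ l′)
NF-unique (e , a0 , a-max , ab , b-max) (e′ , a0′ , a-max′ , ab′ , b-max′)
  with ≤-antisym (a-max′ _ a0) (a-max _ a0′)
... | refl with ≤-antisym (b-max′ _ ab) (b-max _ ab′)
...   | refl = refl , refl , +-cancelˡ-≡ _ _ _ (trans (sym e) e′)

NFBounds-unique : ∀ {k m a b l a′ b′ l′} → NFBounds (suc k) m a b l → NFBounds (suc k) m a′ b′ l′
                → (a ≡ a′) × (b ≡ b′) × (l ≡ l′)
NFBounds-unique nf nf′ = NF-unique (NFBounds⇒NF nf) (NFBounds⇒NF nf′)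

NFBounds-positive : ∀ {k m a b l} → NFBounds (suc k) m a b l → 0 < m
NFBounds-positive {k} {a = a} {b} nf = <-≤-trans (Ack-positive k a b) (NFBounds-Ack≤ nf)

NFBounds-pred : ∀ {k m a b l} → NFBounds k (suc m) a b (suc l) → NFBounds k m a b l
NFBounds-pred {m = m} {l = l} (nfBounds e below-arg below-index) =
  nfBounds (suc-injective (trans e (+-suc _ l))) (<-trans (n<1+n m) below-arg) (<-trans (n<1+n m) below-index)

NFBounds-index< : ∀ {k m a b l} → NFBounds (suc (suc k)) m a b l → a < m
NFBounds-index< {k} {a = a} nf =
  <-≤-trans (index<Ack-zero k a) (≤-trans (Ack-monotone (suc k) a z≤n) (NFBounds-Ack≤ nf))

NFBounds-argument< : ∀ {k m a b l} → NFBounds (suc k) m a b l → b < m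
NFBounds-argument< {k} {a = a} {b} nf = <-≤-trans (Ack-inflationary k a b) (NFBounds-Ack≤ nf)

nf-exists : ∀ k m → 0 < m → NF (suc (suc k)) m (nfa (suc (suc k)) m) (nfb (suc (suc k)) m) (nfl (suc (suc k)) m)
nf-exists k m 0<m = sym (m+[n∸m]≡n Ab≤m) , A0≤m , a-max , Ab≤m , b-max
  where
  K : ℕ
  K = suc (suc k)
  a : ℕ
  a = nfa K m
  A0≤m : Ack a K 0 ≤ m
  A0≤m = maxBelow-satisfies (λ a → Ack a K 0) m m 0<m
  a-max : ∀ a′ → Ack a′ K 0 ≤ m → a′ ≤ a
  a-max a′ le = maxBelow-maximal (λ a → Ack a K 0) m m a′ (<⇒≤ (<-≤-trans (index<Ack-zero k a′) le)) le
  Ab≤m : Ack a K (nfb K m) ≤ m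
  Ab≤m = maxBelow-satisfies (Ack a K) m m A0≤m
  b-max : ∀ b′ → Ack a K b′ ≤ m → b′ ≤ nfb K m
  b-max b′ le = maxBelow-maximal (Ack a K) m m b′ (<⇒≤ (<-≤-trans (Ack-inflationary (suc k) a b′) le)) le

nfBounds-exists : ∀ k m → 0 < m → NFBounds (suc (suc k)) m (nfa (suc (suc k)) m) (nfb (suc (suc k)) m) (nfl (suc (suc k)) m)
nfBounds-exists k m 0<m = NF⇒NFBounds (nf-exists k m 0<m)

applyIf : Bool → (ℕ → ℕ) → ℕ → ℕ
applyIf true  f x = f x
applyIf false f x = x

applyIf-cong : ∀ u {f g : ℕ → ℕ} x → f x ≡ g x → applyIf u f x ≡ applyIf u g x
applyIf-cong true  x e = e
applyIf-cong false x e = refl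

applyIf-elim : ∀ u f {y} (P : ℕ → Set) → P (f y) → P y → P (applyIf u f y)
applyIf-elim true  f P Pfy Py = Pfy
applyIf-elim false f P Pfy Py = Py

module BaseChange (k₀ : ℕ) where

  k : ℕ
  k = suc (suc k₀)

  -- F is a fuelled base change k ← k+1 that changes the index of the normal form
  -- recursively iff s, and its argument iff t.
  IsFuelledBaseChange : Bool → Bool → (ℕ → ℕ → ℕ) → Set
  IsFuelledBaseChange s t F =
    (∀ n → F (suc n) 0 ≡ 0)
    × (∀ n m → F (suc n) (suc m)
               ≡ Ack (applyIf s (F n) (nfa k (suc m))) (suc k) (applyIf t (F n) (nfb k (suc m))) + nfl k (suc m))

  -- The computed components of m+1 are at most m; this bounds the fuel needed.
  nfa< : ∀ m → nfa k (suc m) < suc m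
  nfa< m = NFBounds-index< (nfBounds-exists k₀ (suc m) (s≤s z≤n))

  nfb< : ∀ m → nfb k (suc m) < suc m
  nfb< m = NFBounds-argument< (nfBounds-exists k₀ (suc m) (s≤s z≤n))

  module Uniform (s t : Bool) (F : ℕ → ℕ → ℕ) (isBaseChange : IsFuelledBaseChange s t F) where

    F-zero : ∀ n → F (suc n) 0 ≡ 0
    F-zero = proj₁ isBaseChange

    F-suc : ∀ n m → F (suc n) (suc m)
                  ≡ Ack (applyIf s (F n) (nfa k (suc m))) (suc k) (applyIf t (F n) (nfb k (suc m))) + nfl k (suc m)
    F-suc = proj₂ isBaseChange

    φ : ℕ → ℕ
    φ m = F (suc m) m

    α β : ℕ → ℕ
    α = applyIf s φ
    β = applyIf t φ

    -- Any fuel exceeding m gives the same value, since a, b < m.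
    fuel-irrelevant : ∀ n n' m → m < n → m < n' → F n m ≡ F n' m
    fuel-irrelevant (suc n) (suc n') zero    _ _ = trans (F-zero n) (sym (F-zero n'))
    fuel-irrelevant (suc n) (suc n') (suc m) (s≤s m<n) (s≤s m<n') = begin
      F (suc n) (suc m)
        ≡⟨ F-suc n m ⟩
      Ack (applyIf s (F n) a) (suc k) (applyIf t (F n) b) + l
        ≡⟨ cong₂ (λ x y → Ack x (suc k) y + l)
             (applyIf-cong s a (fuel-irrelevant n n' a (<-≤-trans (nfa< m) m<n) (<-≤-trans (nfa< m) m<n')))
             (applyIf-cong t b (fuel-irrelevant n n' b (<-≤-trans (nfb< m) m<n) (<-≤-trans (nfb< m) m<n'))) ⟩
      Ack (applyIf s (F n') a) (suc k) (applyIf t (F n') b) + l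
        ≡⟨ sym (F-suc n' m) ⟩
      F (suc n') (suc m) ∎
      where
      open ≡-Reasoning
      a b l : ℕ
      a = nfa k (suc m)
      b = nfb k (suc m)
      l = nfl k (suc m)

    φ-zero : φ 0 ≡ 0
    φ-zero = F-zero 0

    φ-on-NF : ∀ {m a b l} → NFBounds k m a b l → φ m ≡ Ack (α a) (suc k) (β b) + l
    φ-on-NF {zero} nf = ⊥-elim (<-irrefl refl (NFBounds-positive nf))
    φ-on-NF {suc m} nf with NFBounds-unique (nfBounds-exists k₀ (suc m) (s≤s z≤n)) nf
    ... | refl , refl , refl =
      trans (F-suc (suc m) m)
        (cong₂ (λ x y → Ack x (suc k) y + nfl k (suc m))
          (applyIf-cong s _ (fuel-irrelevant (suc m) _ _ (nfa< m) ≤-refl))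
          (applyIf-cong t _ (fuel-irrelevant (suc m) _ _ (nfb< m) ≤-refl)))

    IncreasingUpTo : ℕ → Set
    IncreasingUpTo m = ∀ {y z} → y < z → z ≤ m → φ y < φ z

    PreservesNFUpTo : ℕ → Set
    PreservesNFUpTo m = ∀ {y} → y ≤ m → ∀ {a b l} → NFBounds k y a b l → NFBounds (suc k) (φ y) (α a) (β b) l

    Invariant : ℕ → Set
    Invariant m = IncreasingUpTo m × PreservesNFUpTo m

    increasing⇒monotone : ∀ {m} → IncreasingUpTo m → ∀ {y z} → y ≤ z → z ≤ m → φ y ≤ φ z
    increasing⇒monotone inc y≤z z≤m with m≤n⇒m<n∨m≡n y≤z
    ... | inj₁ y<z  = <⇒≤ (inc y<z z≤m)
    ... | inj₂ refl = ≤-refl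

    increasing⇒inflationary : ∀ {m} → IncreasingUpTo m → ∀ {x} → x ≤ m → x ≤ φ x
    increasing⇒inflationary inc {zero}  _   = z≤n
    increasing⇒inflationary inc {suc x} x≤m =
      ≤-<-trans (increasing⇒inflationary inc (<⇒≤ x≤m)) (inc (n<1+n x) x≤m)

    applyIf-increasing : ∀ {m} → IncreasingUpTo m → ∀ u {y z} → y < z → z ≤ m → applyIf u φ y < applyIf u φ z
    applyIf-increasing inc true  y<z z≤m = inc y<z z≤m
    applyIf-increasing inc false y<z z≤m = y<z

    applyIf-inflationary : ∀ {m} → IncreasingUpTo m → ∀ u {x} → x ≤ m → x ≤ applyIf u φ x
    applyIf-inflationary inc true  x≤m = increasing⇒inflationary inc x≤m
    applyIf-inflationary inc false x≤m = ≤-refl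

    -- The normal form of y has index ≤ a: a smaller index is
    -- handled by the index bound of the new normal form of φ y, an equal one by its
    -- argument bound together with the assumed bound on β below d.
    φ-below : ∀ {m} → Invariant m → ∀ {y a d E} → y ≤ m → a ≤ m
            → y < Ack a k d → y < Ack (suc a) k 0
            → (∀ {b} → b < d → b < y → β b < E)
            → φ y < Ack (α a) (suc k) E
    φ-below inv {zero} {a} {d} {E} _ _ _ _ _ = subst (_< Ack (α a) (suc k) E) (sym φ-zero) (Ack-positive k (α a) E)
    φ-below (inc , preserves) {suc y} {a} {d} {E} y≤m a≤m below-d below-index β-below-d =
      by-index (m≤n⇒m<n∨m≡n (index-bound (suc k₀) A′0≤y below-index))
      where
      a′ b′ : ℕ
      a′ = nfa k (suc y)
      b′ = nfb k (suc y)
      nf : NFBounds k (suc y) a′ b′ (nfl k (suc y))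
      nf = nfBounds-exists k₀ (suc y) (s≤s z≤n)
      A′0≤y : Ack a′ k 0 ≤ suc y
      A′0≤y = ≤-trans (Ack-monotone (suc k₀) a′ z≤n) (NFBounds-Ack≤ nf)
      by-index : a′ < a ⊎ a′ ≡ a → φ (suc y) < Ack (α a) (suc k) E
      by-index (inj₁ a′<a) = <-≤-trans (below-next-index (preserves y≤m nf))
        (≤-trans (Ack-monotone-index k 0 (applyIf-increasing inc s a′<a a≤m)) (Ack-monotone k (α a) z≤n))
      by-index (inj₂ refl) = <-≤-trans (below-next-arg (preserves y≤m nf))
        (Ack-monotone k (α a) (β-below-d b′<d (NFBounds-argument< nf)))
        where
        b′<d : b′ < d
        b′<d = argument-bound (suc k₀) {a = a′} {b = b′} (NFBounds-Ack≤ nf) below-d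

    -- β maps numbers below the j-th iterate A_a(k,·)^j(0), j ≤ k, below the j-th
    -- iterate of A_{α a}(k+1,·); for j = k this is the bound A_{a+1}(k,0).
    β-below-iterate : ∀ {m} → Invariant m → ∀ {a} → a ≤ m → ∀ j → j ≤ k → ∀ {y} → y ≤ m
                    → y < iter j (Ack a k) 0 → β y < iter j (Ack (α a) (suc k)) 0
    β-below-iterate inv a≤m zero    _   _   ()
    β-below-iterate inv {a} a≤m (suc j) j<k {y} y≤m y<iter =
      applyIf-elim t φ (_< iter (suc j) (Ack (α a) (suc k)) 0) φ-bound y-bound
      where
      y<Ack-next : y < Ack (suc a) k 0
      y<Ack-next = <-≤-trans y<iter (iter-mono-count (Ack-inflationary (suc k₀) a) j<k 0)
      φ-bound : φ y < iter (suc j) (Ack (α a) (suc k)) 0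
      φ-bound = φ-below inv y≤m a≤m y<iter y<Ack-next
        (λ b<iter b<y → β-below-iterate inv a≤m j (<⇒≤ j<k) (≤-trans (<⇒≤ b<y) y≤m) b<iter)
      y-bound : y < iter (suc j) (Ack (α a) (suc k)) 0
      y-bound = <-≤-trans y<iter (iter-pointwise (Ack-monotone k (α a))
        (λ x → Ack-monotone-all k (applyIf-inflationary (proj₁ inv) s a≤m) ≤-refl) (suc j) 0)

    -- The invariant's normal-form part at m+1: the tail lemma gives the argument
    -- bound, and β b < A_{α a+1}(k+1,0) then gives the index bound.
    preserves-NF-next : ∀ {m} → Invariant m → ∀ {a b l} → NFBounds k (suc m) a b l
                      → NFBounds (suc k) (φ (suc m)) (α a) (β b) l
    preserves-NF-next {m} inv {a} {b} {l} nf = nfBounds φ-eq below-arg below-index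
      where
      φ-eq : φ (suc m) ≡ Ack (α a) (suc k) (β b) + l
      φ-eq = φ-on-NF nf
      a≤m : a ≤ m
      a≤m = s≤s⁻¹ (NFBounds-index< nf)
      b≤m : b ≤ m
      b≤m = s≤s⁻¹ (NFBounds-argument< nf)
      below-arg : φ (suc m) < Ack (α a) (suc k) (suc (β b))
      below-arg = subst (_< Ack (α a) (suc k) (suc (β b))) (sym φ-eq)
        (tail-fits (suc k₀) (applyIf-inflationary (proj₁ inv) s a≤m) (applyIf-inflationary (proj₁ inv) t b≤m)
          (subst (_< Ack a k (suc b)) (decomposition nf) (below-next-arg nf)))
      b<Ack-next : b < Ack (suc a) k 0
      b<Ack-next = <-trans (NFBounds-argument< nf) (below-next-index nf)
      below-index : φ (suc m) < Ack (suc (α a)) (suc k) 0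
      below-index = <-≤-trans below-arg (Ack-monotone k (α a) (β-below-iterate inv a≤m k ≤-refl b≤m b<Ack-next))

    -- The invariant's monotonicity part at m+1.  With a nonzero remainder both
    -- values share a normal form up to the remainder; otherwise m+1 = A_a(k,b) and
    -- φ-below applies to m with d = b.
    φ-step : ∀ {m} → Invariant m → φ m < φ (suc m)
    φ-step {m} inv = from-NF (nfBounds-exists k₀ (suc m) (s≤s z≤n))
      where
      from-NF : ∀ {a b l} → NFBounds k (suc m) a b l → φ m < φ (suc m)
      from-NF {a} {b} {suc l} nf =
        subst₂ _<_ (sym (φ-on-NF (NFBounds-pred nf))) (sym (φ-on-NF nf)) (+-monoʳ-< (Ack (α a) (suc k) (β b)) (n<1+n l))
      from-NF {a} {b} {zero} nf =
        subst (φ m <_) (sym (trans (φ-on-NF nf) (+-identityʳ _)))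
          (φ-below inv ≤-refl a≤m m<Ack (<-trans (n<1+n m) (below-next-index nf))
            (λ b′<b _ → applyIf-increasing (proj₁ inv) t b′<b b≤m))
        where
        a≤m : a ≤ m
        a≤m = s≤s⁻¹ (NFBounds-index< nf)
        b≤m : b ≤ m
        b≤m = s≤s⁻¹ (NFBounds-argument< nf)
        m<Ack : m < Ack a k b
        m<Ack = ≤-reflexive (trans (decomposition nf) (+-identityʳ _))

    invariant : ∀ m → Invariant m
    invariant zero =
      (λ y<z z≤0 → ⊥-elim (n≮0 (<-≤-trans y<z z≤0))) , (λ y≤0 nf → ⊥-elim (<⇒≱ (NFBounds-positive nf) y≤0))
    invariant (suc m) = increasing , preserves
      where
      inv : Invariant m
      inv = invariant m
      increasing : IncreasingUpTo (suc m)
      increasing y<z z≤1+m with m≤n⇒m<n∨m≡n z≤1+m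
      ... | inj₁ z<1+m = proj₁ inv y<z (s≤s⁻¹ z<1+m)
      ... | inj₂ refl  = ≤-<-trans (increasing⇒monotone (proj₁ inv) (s≤s⁻¹ y<z) ≤-refl) (φ-step inv)
      preserves : PreservesNFUpTo (suc m)
      preserves y≤1+m with m≤n⇒m<n∨m≡n y≤1+m
      ... | inj₁ y<1+m = proj₂ inv (s≤s⁻¹ y<1+m)
      ... | inj₂ refl  = preserves-NF-next inv

    φ-inflationary : ∀ m → m ≤ φ m
    φ-inflationary m = increasing⇒inflationary (proj₁ (invariant m)) ≤-refl

    Ack-below-changed : ∀ a b → Ack a k b ≤ Ack (φ a) (suc k) (φ b)
    Ack-below-changed a b = Ack-monotone-all k (φ-inflationary a) (φ-inflationary b)

    -- For m ≥ k the index a of the normal form is nonzero (A_1(k,0) = k), and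
    -- raising the parameter is strict at positive indices.
    φ-strict-above-base : ∀ m → k ≤ m → m < φ m
    φ-strict-above-base (suc m) k≤m = from-NF (nfBounds-exists k₀ (suc m) (s≤s z≤n))
      where
      from-NF : ∀ {a b l} → NFBounds k (suc m) a b l → suc m < φ (suc m)
      from-NF {zero} nf = ⊥-elim (<⇒≱ (subst (suc m <_) (iter-suc-zero k) (below-next-index nf)) k≤m)
      from-NF {suc a} {b} {l} nf = subst₂ _<_ (sym (decomposition nf)) (sym (φ-on-NF nf))
        (+-monoˡ-< l (<-≤-trans (Ack-strict-param k a b)
          (≤-trans (Ack-monotone-index k b a≤αa) (Ack-monotone k (α (suc a)) b≤βb))))
        where
        inc : IncreasingUpTo (suc m)
        inc = proj₁ (invariant (suc m))
        a≤αa : suc a ≤ α (suc a)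
        a≤αa = applyIf-inflationary inc s (<⇒≤ (NFBounds-index< nf))
        b≤βb : b ≤ β b
        b≤βb = applyIf-inflationary inc t (<⇒≤ (NFBounds-argument< nf))

    φ-pred< : ∀ m → 0 < m → φ (m ∸ 1) < φ m
    φ-pred< (suc m) _ = φ-step (invariant m)

    φ-preserves-NF : ∀ m a b l → NF k m a b l → NF (suc k) (φ m) (α a) (β b) l
    φ-preserves-NF m a b l nf = NFBounds⇒NF (proj₂ (invariant m) ≤-refl (NF⇒NFBounds nf))

module Square (k₀ : ℕ) = BaseChange.Uniform k₀ true  true  (bcSqF  (suc (suc k₀))) ((λ _ → refl) , (λ _ _ → refl))
module Angle  (k₀ : ℕ) = BaseChange.Uniform k₀ false true  (bcAngF (suc (suc k₀))) ((λ _ → refl) , (λ _ _ → refl))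
module Curly  (k₀ : ℕ) = BaseChange.Uniform k₀ true  false (bcCurF (suc (suc k₀))) ((λ _ → refl) , (λ _ _ → refl))

mainTheorem4 : (k : ℕ) → 3 ≤ k →
    -- 1.
    ((∀ m → (m ≤ bcSq k m) × (m ≤ bcAng k m) × (m ≤ bcCur k m))
     × (∀ a b → (Ack a k b ≤ Ack (bcSq k a) (suc k) (bcSq k b))
                × (Ack a k b ≤ Ack (bcAng k a) (suc k) (bcAng k b))
                × (Ack a k b ≤ Ack (bcCur k a) (suc k) (bcCur k b))))
    -- 2.
    × (∀ m → k ≤ m → (m < bcSq k m) × (m < bcAng k m) × (m < bcCur k m))
    -- 3.
    × (∀ m → 0 < m → (bcSq k (m ∸ 1) < bcSq k m)
                     × (bcAng k (m ∸ 1) < bcAng k m)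
                     × (bcCur k (m ∸ 1) < bcCur k m))
    -- 4.
    × (∀ m a b l → NF k m a b l →
         NF (suc k) (bcSq k m) (bcSq k a) (bcSq k b) l
         × NF (suc k) (bcAng k m) a (bcAng k b) l
         × NF (suc k) (bcCur k m) (bcCur k a) b l)
mainTheorem4 (suc (suc (suc k₀))) (s≤s (s≤s (s≤s z≤n))) =
    ( (λ m → S.φ-inflationary m , A.φ-inflationary m , C.φ-inflationary m)
    , (λ a b → S.Ack-below-changed a b , A.Ack-below-changed a b , C.Ack-below-changed a b))
  , (λ m k≤m → S.φ-strict-above-base m k≤m , A.φ-strict-above-base m k≤m , C.φ-strict-above-base m k≤m)
  , (λ m 0<m → S.φ-pred< m 0<m , A.φ-pred< m 0<m , C.φ-pred< m 0<m)
  , (λ m a b l nf → S.φ-preserves-NF m a b l nf , A.φ-preserves-NF m a b l nf , C.φ-preserves-NF m a b l nf)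
  where
  module S = Square (suc k₀)
  module A = Angle  (suc k₀)
  module C = Curly  (suc k₀)
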